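{- Let $T$ be a proper binary tree with saturated vertices $u$ and $w$ such that $R_T(u)=R_T(w)$. Let $u_1,w_1$ be the siblings and $u_0,w_0$ the parents of $u,w$ respectively, and assume neither of $u_0,w_0$ is an ancestor of the other. If $R_T(w_1)\ge R_T(u_1)$ and $T^*=T-uu_0-w_1w_0+uw_0+w_1u_0$ (i.e. the subtrees $T(u)$ and $T(w_1)$ are exchanged; $T^*$ has the same root as $T$), then $R(T^*)\ge R(T)$.
   Context: All trees are rooted; $T(v)$ is the subtree induced by $v$ and its descendants; a leaf is a vertex with no children. The rank $R_T(v)$ is the minimum distance from $v$ to a leaf of $T(v)$, and the security is $R(T)=\sum_{v}R_T(v)$. A proper binary tree is an unordered rooted tree in which every non-leaf vertex has exactly two children. A complete binary tree is a proper binary tree whose leaves are all at the same distance from its root. A vertex $v$ of a proper binary tree $T$ is saturated if $T(v)$ is a complete binary tree but $T(x)$ is not a complete binary tree for any proper ancestor $x$ of $v$. -}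

module Defs where

open import Data.Nat using (ℕ; zero; suc; _+_; _⊓_)
open import Data.List using (List; []; _∷_; _++_; map)
open import Data.List.Relation.Unary.All using (All)
open import Data.Maybe using (Maybe; just; nothing)
open import Data.Product using (Σ; ∃; _×_; _,_)
open import Relation.Binary.PropositionalEquality using (_≡_)
open import Relation.Nullary using (¬_)

-- The children are stored in an order only for representation; all notions
-- below (rank, security, completeness) are invariant under swapping them.
data PBT : Set where
  leaf : PBT
  node : PBT → PBT → PBT

-- A vertex is addressed by the path from the root (L = first child, R = second).
data Dir : Set where
  L R : Dir

flip : Dir → Dir
flip L = R
flip R = L

Path : Set
Path = List Dir

sub : PBT → Path → Maybe PBT
sub t [] = just t
sub leaf (_ ∷ _) = nothing
sub (node l r) (L ∷ p) = sub l p
sub (node l r) (R ∷ p) = sub r p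

replace : PBT → Path → PBT → PBT
replace t [] s = s
replace leaf (_ ∷ _) s = leaf
replace (node l r) (L ∷ p) s = node (replace l p s) r
replace (node l r) (R ∷ p) s = node l (replace r p s)

rank : PBT → ℕ
rank leaf = 0
rank (node l r) = suc (rank l ⊓ rank r)

security : PBT → ℕ
security leaf = 0
security (node l r) = rank (node l r) + (security l + security r)

leafDepths : PBT → List ℕ
leafDepths leaf = 0 ∷ []
leafDepths (node l r) = map suc (leafDepths l ++ leafDepths r)

Complete : PBT → Set
Complete t = ∃ λ d → All (_≡ d) (leafDepths t)

ProperAncestor : Path → Path → Set
ProperAncestor q p = ∃ λ d → ∃ λ ds → q ++ (d ∷ ds) ≡ p

Saturated : PBT → Path → Set
Saturated t v =
  (∃ λ s → sub t v ≡ just s × Complete s) ×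
  (∀ x → ProperAncestor x v → ∀ s → sub t x ≡ just s → ¬ Complete s)

{-# OPTIONS --safe #-}
-- Only u0, w0 and their ancestors can change rank: every other vertex keeps its
-- subtree up to isomorphism.  The rank of u0 goes from 1 + min(R(u), R(u1)) to
-- 1 + min(R(w1), R(u1)), which is not smaller as R(w1) ≥ R(u1); that of w0 goes
-- from 1 + min(R(w), R(w1)) to 1 + min(R(w), R(u)) = 1 + R(w).  Rank is monotone
-- in the ranks of the children, so no rank decreases and R(T*) ≥ R(T).
module Submission where

open import Defs
open import Data.Nat using (ℕ; suc; _≥_; _≤_; _+_; _⊓_; s≤s)
open import Data.Nat.Properties
open import Data.Nat.Tactic.RingSolver using (solve-∀)
open import Data.List using ([]; _∷_; _++_)
open import Data.Maybe using (just)
open import Data.Product using (_×_; _,_; proj₂)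
open import Data.Empty using (⊥-elim)
open import Relation.Binary.PropositionalEquality using (_≡_; refl; sym; cong; subst; subst₂)
open import Function using (_∘_)
open import Relation.Nullary using (¬_)

private
  variable
    m m′ a a′ b b′ x y : ℕ
    l l′ r r′ : PBT

+-exchangeˡ-≤ : m ≤ m′ → a + x ≤ a′ + y → m + (a + b) + x ≤ m′ + (a′ + b) + y
+-exchangeˡ-≤ {m} {m′} {a} {x} {a′} {y} {b} m≤m′ a+x≤a′+y = begin
  m + (a + b) + x     ≡⟨ shuffle m a b x ⟩
  m + (b + (a + x))   ≤⟨ +-mono-≤ m≤m′ (+-monoʳ-≤ b a+x≤a′+y) ⟩
  m′ + (b + (a′ + y)) ≡⟨ shuffle m′ a′ b y ⟨
  m′ + (a′ + b) + y   ∎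
  where
  open ≤-Reasoning
  shuffle : ∀ m a b x → m + (a + b) + x ≡ m + (b + (a + x))
  shuffle = solve-∀

+-exchangeʳ-≤ : m ≤ m′ → a + x ≤ a′ + y → m + (b + a) + x ≤ m′ + (b + a′) + y
+-exchangeʳ-≤ {m} {m′} {a} {x} {a′} {y} {b} m≤m′ a+x≤a′+y =
  subst₂ (λ s s′ → m + s + x ≤ m′ + s′ + y) (+-comm a b) (+-comm a′ b)
    (+-exchangeˡ-≤ m≤m′ a+x≤a′+y)

+-exchange-cancel-≤ : ∀ x y → a + x ≤ a′ + y → b + y ≤ b′ + x → a + b ≤ a′ + b′
+-exchange-cancel-≤ {a} {a′} {b} {b′} x y a+x≤a′+y b+y≤b′+x =
  +-cancelʳ-≤ (x + y) (a + b) (a′ + b′)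
    (subst₂ _≤_ (regroup a b x y) (regroup′ a′ b′ y x) (+-mono-≤ a+x≤a′+y b+y≤b′+x))
  where
  regroup : ∀ a b x y → (a + x) + (b + y) ≡ (a + b) + (x + y)
  regroup = solve-∀
  regroup′ : ∀ a b x y → (a + x) + (b + y) ≡ (a + b) + (y + x)
  regroup′ = solve-∀

flip-involutive : ∀ d → flip (flip d) ≡ d
flip-involutive L = refl
flip-involutive R = refl

ProperAncestor-[] : ∀ d (p : Path) → ProperAncestor [] (d ∷ p)
ProperAncestor-[] d p = d , p , refl

ProperAncestor-∷ : ∀ d {p q} → ProperAncestor p q → ProperAncestor (d ∷ p) (d ∷ q)
ProperAncestor-∷ d (e , es , p++e∷es≡q) = e , es , cong (d ∷_) p++e∷es≡q

infix 4 _≼_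

_≼_ : PBT → PBT → Set
s ≼ t = rank s ≤ rank t × security s ≤ security t

node-≼ : rank l ≤ rank l′ → rank r ≤ rank r′ →
         security l + security r ≤ security l′ + security r′ →
         node l r ≼ node l′ r′
node-≼ rl≤rl′ rr≤rr′ sl+sr≤sl′+sr′ = rank≤ , +-mono-≤ rank≤ sl+sr≤sl′+sr′
  where rank≤ = s≤s (⊓-mono-≤ rl≤rl′ rr≤rr′)

node-swap-≼ : ∀ l r → node l r ≼ node r l
node-swap-≼ l r = rank≤ , +-mono-≤ rank≤ (≤-reflexive (+-comm (security l) (security r)))
  where rank≤ = ≤-reflexive (cong suc (⊓-comm (rank l) (rank r)))

module _ {x y z : PBT} where

  replace-child-rank-≤ : ∀ t p c →
    sub t (p ++ c ∷ []) ≡ just y → sub t (p ++ flip c ∷ []) ≡ just z →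
    rank y ⊓ rank z ≤ rank x ⊓ rank z →
    rank t ≤ rank (replace t (p ++ c ∷ []) x)
  replace-child-rank-≤ (node l r) [] L refl refl ry⊓rz≤rx⊓rz = s≤s ry⊓rz≤rx⊓rz
  replace-child-rank-≤ (node l r) [] R refl refl ry⊓rz≤rx⊓rz =
    s≤s (subst₂ _≤_ (⊓-comm (rank r) (rank l)) (⊓-comm (rank x) (rank l)) ry⊓rz≤rx⊓rz)
  replace-child-rank-≤ (node l r) (L ∷ p) c ey ez h =
    s≤s (⊓-monoˡ-≤ (rank r) (replace-child-rank-≤ l p c ey ez h))
  replace-child-rank-≤ (node l r) (R ∷ p) c ey ez h =
    s≤s (⊓-monoʳ-≤ (rank l) (replace-child-rank-≤ r p c ey ez h))

  replace-child-security-≤ : ∀ t p c →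
    sub t (p ++ c ∷ []) ≡ just y → sub t (p ++ flip c ∷ []) ≡ just z →
    rank y ⊓ rank z ≤ rank x ⊓ rank z →
    security t + security x ≤ security (replace t (p ++ c ∷ []) x) + security y
  replace-child-security-≤ t@(node l r) [] L ey@refl ez h =
    +-exchangeˡ-≤ (replace-child-rank-≤ t [] L ey ez h)
                  (≤-reflexive (+-comm (security l) (security x)))
  replace-child-security-≤ t@(node l r) [] R ey@refl ez h =
    +-exchangeʳ-≤ (replace-child-rank-≤ t [] R ey ez h)
                  (≤-reflexive (+-comm (security r) (security x)))
  replace-child-security-≤ t@(node l r) (L ∷ p) c ey ez h =
    +-exchangeˡ-≤ (replace-child-rank-≤ t (L ∷ p) c ey ez h)
                  (replace-child-security-≤ l p c ey ez h)
  replace-child-security-≤ t@(node l r) (R ∷ p) c ey ez h =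
    +-exchangeʳ-≤ (replace-child-rank-≤ t (R ∷ p) c ey ez h)
                  (replace-child-security-≤ r p c ey ez h)

module _ {U W U1 W1 : PBT} where

  exchange-≼ : ∀ T u0 w0 a b →
    sub T (u0 ++ a ∷ []) ≡ just U →
    sub T (w0 ++ b ∷ []) ≡ just W →
    sub T (u0 ++ flip a ∷ []) ≡ just U1 →
    sub T (w0 ++ flip b ∷ []) ≡ just W1 →
    ¬ ProperAncestor u0 w0 →
    ¬ ProperAncestor w0 u0 →
    rank U ⊓ rank U1 ≤ rank W1 ⊓ rank U1 →
    rank W1 ⊓ rank W ≤ rank U ⊓ rank W →
    T ≼ replace (replace T (u0 ++ a ∷ []) W1) (w0 ++ flip b ∷ []) U
  exchange-≼ (node l r) [] [] L L refl refl refl refl _ _ _ _ = node-swap-≼ l r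
  exchange-≼ (node l r) [] [] L R refl refl refl refl _ _ _ _ = ≤-refl , ≤-refl
  exchange-≼ (node l r) [] [] R L refl refl refl refl _ _ _ _ = ≤-refl , ≤-refl
  exchange-≼ (node l r) [] [] R R refl refl refl refl _ _ _ _ = node-swap-≼ l r
  exchange-≼ (node l r) [] (d ∷ w0) _ _ _ _ _ _ ¬u0<w0 _ _ _ =
    ⊥-elim (¬u0<w0 (ProperAncestor-[] d w0))
  exchange-≼ (node l r) (d ∷ u0) [] _ _ _ _ _ _ _ ¬w0<u0 _ _ =
    ⊥-elim (¬w0<u0 (ProperAncestor-[] d u0))
  exchange-≼ (node l r) (L ∷ u0) (L ∷ w0) a b eU eW eU1 eW1 ¬u0<w0 ¬w0<u0 hu hw =
    let rl≤ , sl≤ = exchange-≼ l u0 w0 a b eU eW eU1 eW1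
                      (¬u0<w0 ∘ ProperAncestor-∷ L) (¬w0<u0 ∘ ProperAncestor-∷ L) hu hw
    in node-≼ rl≤ ≤-refl (+-monoˡ-≤ (security r) sl≤)
  exchange-≼ (node l r) (R ∷ u0) (R ∷ w0) a b eU eW eU1 eW1 ¬u0<w0 ¬w0<u0 hu hw =
    let rr≤ , sr≤ = exchange-≼ r u0 w0 a b eU eW eU1 eW1
                      (¬u0<w0 ∘ ProperAncestor-∷ R) (¬w0<u0 ∘ ProperAncestor-∷ R) hu hw
    in node-≼ ≤-refl rr≤ (+-monoʳ-≤ (security l) sr≤)
  exchange-≼ (node l r) (L ∷ u0) (R ∷ w0) a b eU eW eU1 eW1 _ _ hu hw =
    node-≼ (replace-child-rank-≤ l u0 a eU eU1 hu)
           (replace-child-rank-≤ r w0 (flip b) eW1 eW′ hw)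
           (+-exchange-cancel-≤ (security W1) (security U)
              (replace-child-security-≤ l u0 a eU eU1 hu)
              (replace-child-security-≤ r w0 (flip b) eW1 eW′ hw))
    where eW′ = subst (λ c → sub r (w0 ++ c ∷ []) ≡ just W) (sym (flip-involutive b)) eW
  exchange-≼ (node l r) (R ∷ u0) (L ∷ w0) a b eU eW eU1 eW1 _ _ hu hw =
    node-≼ (replace-child-rank-≤ l w0 (flip b) eW1 eW′ hw)
           (replace-child-rank-≤ r u0 a eU eU1 hu)
           (+-exchange-cancel-≤ (security U) (security W1)
              (replace-child-security-≤ l w0 (flip b) eW1 eW′ hw)
              (replace-child-security-≤ r u0 a eU eU1 hu))
    where eW′ = subst (λ c → sub l (w0 ++ c ∷ []) ≡ just W) (sym (flip-involutive b)) eW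

lemma2p4 : (T : PBT) (u0 w0 : Path) (a b : Dir) (U W U1 W1 : PBT) →
    sub T (u0 ++ a ∷ []) ≡ just U →
    sub T (w0 ++ b ∷ []) ≡ just W →
    sub T (u0 ++ flip a ∷ []) ≡ just U1 →
    sub T (w0 ++ flip b ∷ []) ≡ just W1 →
    Saturated T (u0 ++ a ∷ []) →
    Saturated T (w0 ++ b ∷ []) →
    rank U ≡ rank W →
    ¬ ProperAncestor u0 w0 →
    ¬ ProperAncestor w0 u0 →
    rank W1 ≥ rank U1 →
    security (replace (replace T (u0 ++ a ∷ []) W1) (w0 ++ flip b ∷ []) U)
    ≥ security T
lemma2p4 T u0 w0 a b U W U1 W1 eU eW eU1 eW1 _ _ rU≡rW ¬u0<w0 ¬w0<u0 rU1≤rW1 =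
  proj₂ (exchange-≼ T u0 w0 a b eU eW eU1 eW1 ¬u0<w0 ¬w0<u0 u0-rank-≤ w0-rank-≤)
  where
  u0-rank-≤ : rank U ⊓ rank U1 ≤ rank W1 ⊓ rank U1
  u0-rank-≤ = ⊓-glb (≤-trans (m⊓n≤n _ _) rU1≤rW1) (m⊓n≤n _ _)
  w0-rank-≤ : rank W1 ⊓ rank W ≤ rank U ⊓ rank W
  w0-rank-≤ = ⊓-glb (≤-trans (m⊓n≤n _ _) (≤-reflexive (sym rU≡rW))) (m⊓n≤n _ _)
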